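{- Let $T$ be a tree and $v$ a core of $T$ such that every subtree of a neighbor of $v$ is a g-leg of $v$ (so every core other than $v$ lies on a modified leg of $v$), and $v$ has at least three g-legs. Let $L\subseteq V$ contain a local set of $v$. Then $L$ is a landmark set of $T$ in each of the following cases: (1) $L$ contains at least one vertex of each g-leg of $v$; (2) $v$ has at least four g-legs; (3) at least two g-legs of $v$ are modified legs; (4) $v\in L$.
   Context: Let $T=(V,E)$ be a finite tree and $d(x,y)$ the number of edges on the path between $x$ and $y$. A vertex $\tau$ separates $u$ and $w$ if $d(u,\tau)\neq d(w,\tau)$. A set $L\subseteq V$ is a landmark set if every pair of distinct vertices $u,w\in V\setminus L$ is separated by at least two vertices of $L$. A core is a vertex of degree at least $3$. For a vertex $v$, the subtrees of the neighbors of $v$ are the connected components of $T-v$. A (standard) leg of a core $v$ is a subtree of a neighbor of $v$ containing no core (a path attached to $v$); it is short if it has one vertex and long otherwise. For a leg $\ell$ of $v$, $\ell^i$ denotes the vertex of $\ell$ at distance $i$ from $v$ (its position is $i$). A small core is a core of degree exactly $3$ with at least two legs, at least one of which is short; other cores are regular. A modified leg of a core $v$ is a subtree of a neighbor of $v$ containing exactly one core, which is a small core $w$; the position of a vertex on it is its distance from $v$; if $w$ has position $i$, the two vertices of position $i+1$ are $\ell^a,\ell^b$, where $\ell^b$ is the vertex of a short leg of $w$ (chosen arbitrarily if both legs of $w$ inside $\ell$ are short). A g-leg of $v$ is a standard leg or a modified leg of $v$. Solution types. For a set $S$ and a standard leg $\ell$, $S\cap\ell$ is of type $(s,0)$ if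 empty; $(s,1)$ if it is a single vertex of position at least $2$; $(s,2)$ if it has at least two vertices; $(s,3)$ if it equals $\{\ell^1\}$. For a modified leg $\ell$ whose small core has position $i$: type $(m,1)$ if $S\cap\ell$ equals $\{\ell^a\}$ or $\{\ell^b\}$; type $(m,2)$ if it contains neither $\ell^a$ nor $\ell^b$ and contains at least two vertices of position at least $i+2$; type $(m,3)$ if it has at least two vertices, at least one of which is $\ell^a$ or $\ell^b$. A local set of a core $v$ is a set $S$ of vertices of the g-legs of $v$ (so $v\notin S$) such that: (1) at most one standard leg has type $(s,0)$ and all other standard legs have type $(s,1)$, $(s,2)$ or $(s,3)$; (2) every modified leg has type $(m,1)$, $(m,2)$ or $(m,3)$; (3) if some standard leg has type $(s,0)$ then no modified leg has type $(m,1)$; (4) if some long leg $\ell$ has type $(s,0)$ then every long leg other than $\ell$ has type $(s,2)$; (5) if some short leg has type $(s,0)$ then every long leg has type $(s,2)$ or $(s,3)$. "$L$ contains a local set of $v$" means some subset of $L$ is a local set of $v$. -}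

module Defs where

open import Data.Nat using (ℕ; zero; suc; _≤_)
open import Data.Fin using (Fin)
open import Data.Fin.Subset using (Subset; _∈_; _∉_; ∣_∣)
open import Data.Vec using (tabulate)
open import Data.Bool using (Bool; true)
open import Data.List using (List; []; _∷_; length)
open import Data.List.Membership.Propositional using () renaming (_∈_ to _∈ₗ_; _∉_ to _∉ₗ_)
open import Data.List.Relation.Unary.Unique.Propositional using (Unique)
open import Data.Product using (Σ; ∃; _×_; _,_)
open import Data.Sum using (_⊎_)
open import Relation.Binary.PropositionalEquality using (_≡_; _≢_)
open import Relation.Nullary using (¬_)

Graph : ℕ → Set
Graph n = Fin n → Fin n → Bool

module _ {n : ℕ} (G : Graph n) where

  Adj : Fin n → Fin n → Set
  Adj x y = G x y ≡ true

  data Walk : Fin n → Fin n → Set where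
    [_]  : (x : Fin n) → Walk x x
    step : (x : Fin n) {y z : Fin n} → Adj x y → Walk y z → Walk x z

  verts : {x y : Fin n} → Walk x y → List (Fin n)
  verts [ x ] = x ∷ []
  verts (step x _ w) = x ∷ verts w

  len : {x y : Fin n} → Walk x y → ℕ
  len [ x ] = zero
  len (step x _ w) = suc (len w)

  IsPath : {x y : Fin n} → Walk x y → Set
  IsPath w = Unique (verts w)

  record IsTree : Set where
    field
      sym     : ∀ x y → Adj x y → Adj y x
      irrefl  : ∀ x → ¬ Adj x x
      conn    : ∀ x y → Walk x y
      unique  : ∀ x y (p q : Walk x y) → IsPath p → IsPath q → verts p ≡ verts q

  Dist : Fin n → Fin n → ℕ → Set
  Dist x y k = Σ (Walk x y) (λ w → len w ≡ k) × (∀ (w : Walk x y) → k ≤ len w)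

  -- τ separates u and w : d(u,τ) ≠ d(w,τ)
  Separates : Fin n → Fin n → Fin n → Set
  Separates τ u w = ∀ k → Dist u τ k → ¬ Dist w τ k

  IsLandmark : Subset n → Set
  IsLandmark L = ∀ u w → u ∉ L → w ∉ L → u ≢ w →
    ∃ λ τ₁ → ∃ λ τ₂ → τ₁ ∈ L × τ₂ ∈ L × τ₁ ≢ τ₂ × Separates τ₁ u w × Separates τ₂ u w

  deg : Fin n → ℕ
  deg v = ∣ tabulate (G v) ∣

  IsCore : Fin n → Set
  IsCore v = 3 ≤ deg v

  -- x lies in the subtree of the neighbor u of v (the component of T - v containing u)
  InBranch : Fin n → Fin n → Fin n → Set
  InBranch v u x = Adj v u × Σ (Walk u x) (λ w → v ∉ₗ verts w)

  IsLeg : Fin n → Fin n → Set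
  IsLeg v u = Adj v u × (∀ x → InBranch v u x → ¬ IsCore x)

  IsShort : Fin n → Fin n → Set
  IsShort v u = ∀ x → InBranch v u x → x ≡ u

  IsLong : Fin n → Fin n → Set
  IsLong v u = ¬ IsShort v u

  IsSmallCore : Fin n → Set
  IsSmallCore w = deg w ≡ 3 ×
    ∃ λ u₁ → ∃ λ u₂ → u₁ ≢ u₂ × IsLeg w u₁ × IsLeg w u₂ × IsShort w u₁

  IsModLeg : Fin n → Fin n → Fin n → Set
  IsModLeg v u w = Adj v u × InBranch v u w × IsSmallCore w ×
    (∀ x → InBranch v u x → IsCore x → x ≡ w)

  IsGLeg : Fin n → Fin n → Set
  IsGLeg v u = IsLeg v u ⊎ ∃ λ w → IsModLeg v u w

  -- x is one of ℓ^a, ℓ^b : a vertex of the leg with position (position of w) + 1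
  IsTip : Fin n → Fin n → Fin n → Fin n → Set
  IsTip v u w x = InBranch v u x × ∃ λ i → Dist v w i × Dist v x (suc i)

  InSL : Subset n → Fin n → Fin n → Fin n → Set
  InSL S v u x = InBranch v u x × x ∈ S

  TwoIn : Subset n → Fin n → Fin n → Set
  TwoIn S v u = ∃ λ x → ∃ λ y → x ≢ y × InSL S v u x × InSL S v u y

  TypeS0 TypeS1 TypeS2 TypeS3 : Subset n → Fin n → Fin n → Set
  TypeS0 S v u = ∀ x → ¬ InSL S v u x
  TypeS1 S v u = ∃ λ x → InSL S v u x × (∀ y → InSL S v u y → y ≡ x) ×
                   ∃ λ k → Dist v x k × 2 ≤ k
  TypeS2 S v u = TwoIn S v u
  TypeS3 S v u = InSL S v u u × (∀ y → InSL S v u y → y ≡ u)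

  TypeM1 TypeM2 TypeM3 : Subset n → Fin n → Fin n → Fin n → Set
  TypeM1 S v u w = ∃ λ x → IsTip v u w x × InSL S v u x × (∀ y → InSL S v u y → y ≡ x)
  TypeM2 S v u w = (∀ x → IsTip v u w x → ¬ InSL S v u x) ×
    ∃ λ i → Dist v w i ×
      ∃ λ x → ∃ λ y → x ≢ y × InSL S v u x × InSL S v u y ×
        (∃ λ k → Dist v x k × suc (suc i) ≤ k) × (∃ λ k → Dist v y k × suc (suc i) ≤ k)
  TypeM3 S v u w = TwoIn S v u × ∃ λ z → IsTip v u w z × InSL S v u z

  record IsLocalSet (v : Fin n) (S : Subset n) : Set where
    field
      inLegs : ∀ x → x ∈ S → ∃ λ u → IsGLeg v u × InBranch v u x
      c1-types : ∀ u → IsLeg v u →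
        TypeS0 S v u ⊎ TypeS1 S v u ⊎ TypeS2 S v u ⊎ TypeS3 S v u
      c1-atMostOne : ∀ u u' → IsLeg v u → IsLeg v u' →
        TypeS0 S v u → TypeS0 S v u' → u ≡ u'
      c2 : ∀ u w → IsModLeg v u w → TypeM1 S v u w ⊎ TypeM2 S v u w ⊎ TypeM3 S v u w
      c3 : ∀ u → IsLeg v u → TypeS0 S v u → ∀ u' w → IsModLeg v u' w → ¬ TypeM1 S v u' w
      c4 : ∀ u → IsLeg v u → IsLong v u → TypeS0 S v u →
        ∀ u' → IsLeg v u' → IsLong v u' → u' ≢ u → TypeS2 S v u'
      c5 : ∀ u → IsLeg v u → IsShort v u → TypeS0 S v u →
        ∀ u' → IsLeg v u' → IsLong v u' → TypeS2 S v u' ⊎ TypeS3 S v u'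

  _⊆ₛ_ : Subset n → Subset n → Set
  S ⊆ₛ L = ∀ x → x ∈ S → x ∈ L

  ContainsLocalSet : Fin n → Subset n → Set
  ContainsLocalSet v L = ∃ λ S → S ⊆ₛ L × IsLocalSet v S

module Submission where

-- With depth x = d(v,x), distinct x, y ∉ L are
-- separated by two vertices of L as follows.
--   I.   depth y < depth x: every t outside the branch of x (or t = v) has
--        d(x,t) = depth x + depth t > d(y,t), and the local-set axioms together
--        with any of the four alternative hypotheses give two such t in L.
--   IIa. equal depth, different branches: vertices of L in the branch of x (or of
--        y) are closer to x (to y); the local-set axioms provide two of them.
--   IIb. equal depth, same branch: the x–y path turns at a core, so the branch is
--        a modified leg and {x,y} are the children of its small core w; the two
--        deep vertices of a type (m,2) solution separate them, while types (m,1)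
--        and (m,3) would put a child of w into L.

open import Defs
open import Data.Nat using (ℕ; zero; suc; _+_; _≤_; _<_; z≤n; s≤s; s≤s⁻¹; _≤?_)
open import Data.Nat.Properties
  using (≤-trans; ≤-refl; ≤-antisym; n≤1+n; m≤n⇒m≤1+n; +-comm; suc-injective;
         1+n≰n; n≢0⇒n>0; m≢1+m+n; _≟_; <-irrefl; <⇒≱; ≤∧≢⇒<; <-cmp; +-cancelˡ-≡; +-monoˡ-<; module ≤-Reasoning)
open import Data.Fin using (Fin; zero; suc) renaming (_≟_ to _≟F_)
open import Data.Fin.Subset using (Subset; _∈_; _∉_; ∣_∣; inside; outside)
open import Data.Vec using (_∷_; here; there; tabulate)
open import Data.Vec.Properties using (lookup∘tabulate; lookup⇒[]=; []=⇒lookup)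
open import Data.List using (List; []; _∷_; length)
open import Data.List.Membership.Propositional using () renaming (_∈_ to _∈ₗ_; _∉_ to _∉ₗ_)
open import Data.List.Relation.Unary.Any using (here; there)
open import Data.List.Relation.Unary.All using (All; []; _∷_) renaming (map to All-map)
open import Data.List.Relation.Unary.All.Properties using (¬Any⇒All¬; All¬⇒¬Any)
open import Data.List.Relation.Unary.AllPairs using ([]; _∷_)
open import Data.List.Relation.Unary.Unique.Propositional using (Unique)
open import Data.Product using (Σ; ∃; ∃₂; _×_; _,_; proj₁; proj₂)
open import Data.Sum using (_⊎_; inj₁; inj₂; [_,_]′)
open import Data.Empty using (⊥; ⊥-elim)
open import Relation.Binary using (tri<; tri≈; tri>)
open import Relation.Binary.PropositionalEquality
  using (_≡_; _≢_; refl; sym; trans; cong; cong₂; subst; subst₂; module ≡-Reasoning)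
open import Relation.Nullary using (¬_; yes; no)

-- Counting members of a finite subset: enough to turn degree bounds into
-- distinct neighbours and, conversely, distinct neighbours into degree bounds.

remove : ∀ {n} → Subset n → Fin n → Subset n
remove (_ ∷ p) zero    = outside ∷ p
remove (s ∷ p) (suc x) = s ∷ remove p x

∣remove∣ : ∀ {n} {p : Subset n} {x} → x ∈ p → ∣ p ∣ ≡ suc ∣ remove p x ∣
∣remove∣ here = refl
∣remove∣ {p = inside  ∷ _} (there m) = cong suc (∣remove∣ m)
∣remove∣ {p = outside ∷ _} (there m) = ∣remove∣ m

∣p∣≤1+∣remove∣ : ∀ {n} (p : Subset n) x → ∣ p ∣ ≤ suc ∣ remove p x ∣
∣p∣≤1+∣remove∣ (inside  ∷ p) zero    = ≤-refl
∣p∣≤1+∣remove∣ (outside ∷ p) zero    = n≤1+n _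
∣p∣≤1+∣remove∣ (inside  ∷ p) (suc x) = s≤s (∣p∣≤1+∣remove∣ p x)
∣p∣≤1+∣remove∣ (outside ∷ p) (suc x) = ∣p∣≤1+∣remove∣ p x

remove-⊆ : ∀ {n} {p : Subset n} {x y} → y ∈ remove p x → y ∈ p
remove-⊆ {p = _ ∷ _} {x = suc x} here      = here
remove-⊆ {p = _ ∷ _} {x = zero}  (there m) = there m
remove-⊆ {p = _ ∷ _} {x = suc x} (there m) = there (remove-⊆ m)

remove-≢ : ∀ {n} {p : Subset n} {x y} → y ∈ remove p x → y ≢ x
remove-≢ {p = _ ∷ _} {x = suc x} here      ()
remove-≢ {p = _ ∷ _} {x = zero}  (there m) ()
remove-≢ {p = _ ∷ _} {x = suc x} (there m) refl = remove-≢ m refl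

∈-remove : ∀ {n} {p : Subset n} {x y} → y ∈ p → y ≢ x → y ∈ remove p x
∈-remove {x = zero}  here      y≢x = ⊥-elim (y≢x refl)
∈-remove {x = suc x} here      _   = here
∈-remove {x = zero}  (there m) _   = there m
∈-remove {x = suc x} (there m) y≢x = there (∈-remove m (λ e → y≢x (cong suc e)))

distinct≤∣p∣ : ∀ {n} {p : Subset n} (xs : List (Fin n)) → Unique xs → All (_∈ p) xs → length xs ≤ ∣ p ∣
distinct≤∣p∣ [] _ _ = z≤n
distinct≤∣p∣ {p = p} (x ∷ xs) (x∉xs ∷ u) (m ∷ ms) =
  subst (suc (length xs) ≤_) (sym (∣remove∣ m)) (s≤s (distinct≤∣p∣ xs u (keep x∉xs ms)))
  where
    keep : ∀ {ys} → All (x ≢_) ys → All (_∈ p) ys → All (_∈ remove p x) ys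
    keep [] [] = []
    keep (x≢y ∷ ns) (my ∷ mys) = ∈-remove my (λ e → x≢y (sym e)) ∷ keep ns mys

nonempty : ∀ {n} {p : Subset n} → 1 ≤ ∣ p ∣ → ∃ λ x → x ∈ p
nonempty {p = inside  ∷ p} _ = zero , here
nonempty {p = outside ∷ p} h with nonempty {p = p} h
... | x , m = suc x , there m

pick : ∀ {n} {p : Subset n} k → suc k ≤ ∣ p ∣ → ∃ λ x → x ∈ p × k ≤ ∣ remove p x ∣
pick k h with nonempty (≤-trans (s≤s z≤n) h)
... | x , m = x , m , s≤s⁻¹ (subst (suc k ≤_) (∣remove∣ m) h)

Distinct₂ : ∀ {n} → Subset n → Set
Distinct₂ p = ∃₂ λ a b → a ∈ p × b ∈ p × a ≢ b

Distinct₃ : ∀ {n} → Subset n → Set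
Distinct₃ p = ∃₂ λ a b → ∃ λ c → a ∈ p × b ∈ p × c ∈ p × a ≢ b × a ≢ c × b ≢ c

members₂ : ∀ {n} {p : Subset n} → 2 ≤ ∣ p ∣ → Distinct₂ p
members₂ h with pick 1 h
... | a , ma , h' with nonempty h'
... | b , mb = a , b , ma , remove-⊆ mb , λ e → remove-≢ mb (sym e)

members₃ : ∀ {n} {p : Subset n} → 3 ≤ ∣ p ∣ → Distinct₃ p
members₃ h with pick 2 h
... | a , ma , h' with members₂ h'
... | b , c , mb , mc , b≢c =
  a , b , c , ma , remove-⊆ mb , remove-⊆ mc , (λ e → remove-≢ mb (sym e)) , (λ e → remove-≢ mc (sym e)) , b≢c

others : ∀ {n} {p : Subset n} k x → suc k ≤ ∣ p ∣ → k ≤ ∣ remove p x ∣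
others {p = p} k x h = s≤s⁻¹ (≤-trans h (∣p∣≤1+∣remove∣ p x))

module Walks {n : ℕ} (G : Graph n) where
  open import Data.List.Membership.DecPropositional (_≟F_ {n}) using (_∈?_)

  V : Set
  V = Fin n

  infixr 5 _++ʷ_
  _++ʷ_ : ∀ {x y z} → Walk G x y → Walk G y z → Walk G x z
  [ _ ] ++ʷ q = q
  step x a w ++ʷ q = step x a (w ++ʷ q)

  len-++ : ∀ {x y z} (p : Walk G x y) (q : Walk G y z) → len G (p ++ʷ q) ≡ len G p + len G q
  len-++ [ _ ] q = refl
  len-++ (step x a p) q = cong suc (len-++ p q)

  ∈-++⁻ : ∀ {x y z c} (p : Walk G x y) (q : Walk G y z) → c ∈ₗ verts G (p ++ʷ q) → c ∈ₗ verts G p ⊎ c ∈ₗ verts G q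
  ∈-++⁻ [ _ ] q m = inj₂ m
  ∈-++⁻ (step x a p) q (here e) = inj₁ (here e)
  ∈-++⁻ (step x a p) q (there m) with ∈-++⁻ p q m
  ... | inj₁ m' = inj₁ (there m')
  ... | inj₂ m' = inj₂ m'

  ∈-++⁺ʳ : ∀ {x y z c} (p : Walk G x y) (q : Walk G y z) → c ∈ₗ verts G q → c ∈ₗ verts G (p ++ʷ q)
  ∈-++⁺ʳ [ _ ] q m = m
  ∈-++⁺ʳ (step x a p) q m = there (∈-++⁺ʳ p q m)

  head∈ : ∀ {x y} (w : Walk G x y) → x ∈ₗ verts G w
  head∈ [ _ ] = here refl
  head∈ (step _ _ _) = here refl

  last∈ : ∀ {x y} (w : Walk G x y) → y ∈ₗ verts G w
  last∈ [ _ ] = here refl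
  last∈ (step _ _ w) = there (last∈ w)

  len-verts : ∀ {x y} (w : Walk G x y) → length (verts G w) ≡ suc (len G w)
  len-verts [ _ ] = refl
  len-verts (step _ _ w) = cong suc (len-verts w)

  all-head : ∀ {P : V → Set} {x y} (w : Walk G x y) → All P (verts G w) → P x
  all-head [ _ ] (h ∷ _) = h
  all-head (step _ _ _) (h ∷ _) = h

  _⊆_ : List V → List V → Set
  xs ⊆ ys = ∀ {z} → z ∈ₗ xs → z ∈ₗ ys

  suffixFrom : ∀ {x y z} (q : Walk G y z) → x ∈ₗ verts G q → Walk G x z
  suffixFrom [ _ ] (here refl) = [ _ ]
  suffixFrom (step y a q) (here refl) = step y a q
  suffixFrom (step y a q) (there m) = suffixFrom q m

  suffixFrom-path : ∀ {x y z} (q : Walk G y z) (m : x ∈ₗ verts G q) → IsPath G q → IsPath G (suffixFrom q m)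
  suffixFrom-path [ _ ] (here refl) u = u
  suffixFrom-path (step y a q) (here refl) u = u
  suffixFrom-path (step y a q) (there m) (_ ∷ u) = suffixFrom-path q m u

  suffixFrom-⊆ : ∀ {x y z} (q : Walk G y z) (m : x ∈ₗ verts G q) → verts G (suffixFrom q m) ⊆ verts G q
  suffixFrom-⊆ [ _ ] (here refl) k = k
  suffixFrom-⊆ (step y a q) (here refl) k = k
  suffixFrom-⊆ (step y a q) (there m) k = there (suffixFrom-⊆ q m k)

  suffixFrom-len : ∀ {x y z} (q : Walk G y z) (m : x ∈ₗ verts G q) → len G (suffixFrom q m) ≤ len G q
  suffixFrom-len [ _ ] (here refl) = z≤n
  suffixFrom-len (step y a q) (here refl) = ≤-refl
  suffixFrom-len (step y a q) (there m) = m≤n⇒m≤1+n (suffixFrom-len q m)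

  record Shortening {x y} (w : Walk G x y) : Set where
    constructor shortening
    field
      walk    : Walk G x y
      isPath  : IsPath G walk
      ⊆w      : verts G walk ⊆ verts G w
      ≤w      : len G walk ≤ len G w
      same    : len G walk ≡ len G w → verts G walk ≡ verts G w

  shorten : ∀ {x y} (w : Walk G x y) → Shortening w
  shorten [ x ] = shortening [ x ] ([] ∷ []) (λ k → k) z≤n (λ _ → refl)
  shorten (step x a w) with shorten w
  ... | shortening q pq sub le eqv with x ∈? verts G q
  ...   | yes m = shortening (suffixFrom q m) (suffixFrom-path q m pq)
                    (λ k → there (sub (suffixFrom-⊆ q m k)))
                    (m≤n⇒m≤1+n shorter)
                    (λ e → ⊥-elim (1+n≰n (subst (_≤ len G w) e shorter)))
    where
      shorter : len G (suffixFrom q m) ≤ len G w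
      shorter = ≤-trans (suffixFrom-len q m) le
  ...   | no x∉q = shortening (step x a q) (¬Any⇒All¬ (verts G q) x∉q ∷ pq)
                    (λ { (here e) → here e ; (there k) → there (sub k) }) (s≤s le)
                    (λ e → cong (x ∷_) (eqv (suc-injective e)))

  record Split {x y} (c : V) (w : Walk G x y) : Set where
    constructor splitAt
    field
      pre     : Walk G x c
      suf     : Walk G c y
      prePath : IsPath G pre
      sufPath : IsPath G suf
      lenSum  : len G pre + len G suf ≡ len G w
      pre⊆    : verts G pre ⊆ verts G w

  split : ∀ {x y c} (w : Walk G x y) → IsPath G w → c ∈ₗ verts G w → Split c w
  split [ x ] pw (here refl) = splitAt [ x ] [ x ] ([] ∷ []) pw refl (λ k → k)
  split (step x a w) pw (here refl) =
    splitAt [ x ] (step x a w) ([] ∷ []) pw refl (λ { (here e) → here e ; (there ()) })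
  split (step x a w) (px ∷ pw) (there m) with split w pw m
  ... | splitAt pre suf ppre psuf ls sub =
        splitAt (step x a pre) suf (¬Any⇒All¬ (verts G pre) (λ k → All¬⇒¬Any px (sub k)) ∷ ppre) psuf
                (cong suc ls) (λ { (here e) → here e ; (there k) → there (sub k) })

  snoc-path : ∀ {x y z} (w : Walk G x y) → IsPath G w → z ∉ₗ verts G w → (a : Adj G y z) →
    IsPath G (w ++ʷ step y a [ z ])
  snoc-path [ x ] _ z∉ a = ((λ e → z∉ (here (sym e))) ∷ []) ∷ [] ∷ []
  snoc-path {z = z} (step x a' w) (px ∷ pw) z∉ a =
    ¬Any⇒All¬ _ (λ m → x∉ (∈-++⁻ w _ m)) ∷ snoc-path w pw (λ m → z∉ (there m)) a
    where
      x∉ : x ∈ₗ verts G w ⊎ x ∈ₗ verts G (step _ a [ z ]) → ⊥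
      x∉ (inj₁ m) = All¬⇒¬Any px m
      x∉ (inj₂ (here e)) = All¬⇒¬Any px (subst (_∈ₗ verts G w) (sym e) (last∈ w))
      x∉ (inj₂ (there (here e))) = z∉ (here (sym e))

-- Since paths are unique, d x y is the length of the
-- path between x and y; the key tool is the cut-vertex criterion: d x y splits as
-- d x c + d c y exactly when c lies on every walk from x to y.
module TreeMetric {n : ℕ} (G : Graph n) (T : IsTree G) where
  open IsTree T renaming (sym to adj-sym)
  open Walks G public
  open import Data.List.Membership.DecPropositional (_≟F_ {n}) using (_∈?_)

  rev : ∀ {x y} → Walk G x y → Walk G y x
  rev [ x ] = [ x ]
  rev (step x a w) = rev w ++ʷ step _ (adj-sym _ _ a) [ x ]

  len-rev : ∀ {x y} (w : Walk G x y) → len G (rev w) ≡ len G w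
  len-rev [ _ ] = refl
  len-rev (step x a w) = begin
    len G (rev w ++ʷ step _ _ [ x ])  ≡⟨ len-++ (rev w) _ ⟩
    len G (rev w) + 1                 ≡⟨ +-comm (len G (rev w)) 1 ⟩
    suc (len G (rev w))               ≡⟨ cong suc (len-rev w) ⟩
    suc (len G w)                     ∎
    where open ≡-Reasoning

  ∈-rev : ∀ {x y c} (w : Walk G x y) → c ∈ₗ verts G (rev w) → c ∈ₗ verts G w
  ∈-rev [ _ ] m = m
  ∈-rev (step x a w) m with ∈-++⁻ (rev w) _ m
  ... | inj₁ m' = there (∈-rev w m')
  ... | inj₂ (here e) = there (subst (_∈ₗ verts G w) (sym e) (head∈ w))
  ... | inj₂ (there (here e)) = here e

  path : ∀ x y → Walk G x y
  path x y = Shortening.walk (shorten (conn x y))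

  path-isPath : ∀ x y → IsPath G (path x y)
  path-isPath x y = Shortening.isPath (shorten (conn x y))

  d : V → V → ℕ
  d x y = len G (path x y)

  path-len : ∀ {x y} (q : Walk G x y) → IsPath G q → len G q ≡ d x y
  path-len {x} {y} q pq = suc-injective (begin
    suc (len G q)                  ≡⟨ sym (len-verts q) ⟩
    length (verts G q)             ≡⟨ cong length (unique x y q (path x y) pq (path-isPath x y)) ⟩
    length (verts G (path x y))    ≡⟨ len-verts (path x y) ⟩
    suc (d x y)                    ∎)
    where open ≡-Reasoning

  d-min : ∀ {x y} (w : Walk G x y) → d x y ≤ len G w
  d-min w with shorten w
  ... | shortening q pq _ le _ = subst (_≤ len G w) (path-len q pq) le

  dist-uniq : ∀ {x y k} → Dist G x y k → k ≡ d x y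
  dist-uniq {x} {y} ((w , e) , m) = ≤-antisym (m (path x y)) (subst (d x y ≤_) e (d-min w))

  d-sym : ∀ x y → d x y ≡ d y x
  d-sym x y = ≤-antisym (subst (d x y ≤_) (len-rev (path y x)) (d-min (rev (path y x))))
                        (subst (d y x ≤_) (len-rev (path x y)) (d-min (rev (path x y))))

  d-triangle : ∀ x y z → d x z ≤ d x y + d y z
  d-triangle x y z = subst (d x z ≤_) (len-++ (path x y) (path y z)) (d-min (path x y ++ʷ path y z))

  d≡0 : ∀ {x y} → d x y ≡ 0 → x ≡ y
  d≡0 {x} {y} e = go (path x y) e
    where
      go : (w : Walk G x y) → len G w ≡ 0 → x ≡ y
      go [ _ ] _ = refl

  d-refl : ∀ x → d x x ≡ 0
  d-refl x = ≤-antisym (d-min [ x ]) z≤n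

  d≡1⇒adj : ∀ {x y} → d x y ≡ 1 → Adj G x y
  d≡1⇒adj {x} {y} e = go (path x y) e
    where
      go : (w : Walk G x y) → len G w ≡ 1 → Adj G x y
      go (step _ a [ _ ]) _ = a

  adj⇒d≡1 : ∀ {x y} → Adj G x y → d x y ≡ 1
  adj⇒d≡1 {x} {y} a = ≤-antisym (d-min (step x a [ y ]))
    (n≢0⇒n>0 (λ e → irrefl y (subst (λ z → Adj G z y) (d≡0 e) a)))

  Avoids : V → V → V → Set
  Avoids c x y = Σ (Walk G x y) (λ w → c ∉ₗ verts G w)

  Avoids-sym : ∀ {c x y} → Avoids c x y → Avoids c y x
  Avoids-sym (w , av) = rev w , (λ m → av (∈-rev w m))

  Avoids-trans : ∀ {c x y z} → Avoids c x y → Avoids c y z → Avoids c x z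
  Avoids-trans (p , ap) (q , aq) = p ++ʷ q , λ m → [ ap , aq ]′ (∈-++⁻ p q m)

  avoids-path : ∀ {c x y} → Avoids c x y → (q : Walk G x y) → IsPath G q → c ∉ₗ verts G q
  avoids-path {c} {x} {y} (w , av) q pq m with shorten w
  ... | shortening e pe sub _ _ = av (sub (subst (c ∈ₗ_) (unique x y q e pq pe) m))

  -- two neighbours of c joined by a walk avoiding c coincide (no cycles)
  neighbour-unique : ∀ {c b y} → Adj G c b → Adj G c y → Avoids c b y → y ≡ b
  neighbour-unique {c} {b} {y} acb acy r with y ≟F b
  ... | yes e = e
  ... | no y≢b = ⊥-elim (avoids-path r cycle isPath (there (here refl)))
    where
      cycle : Walk G b y
      cycle = step b (adj-sym c b acb) (step c acy [ y ])
      isPath : IsPath G cycle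
      isPath = ((λ e → irrefl c (subst (Adj G c) e acb)) ∷ (λ e → y≢b (sym e)) ∷ [])
             ∷ ((λ e → irrefl c (subst (Adj G c) (sym e) acy)) ∷ []) ∷ [] ∷ []

  branch-unique : ∀ {c a b t} → InBranch G c a t → InBranch G c b t → a ≡ b
  branch-unique (aca , ra) (acb , rb) = sym (neighbour-unique aca acb (Avoids-trans ra (Avoids-sym rb)))

  branch-exists : ∀ {c t} → t ≢ c → Σ V (λ a → InBranch G c a t)
  branch-exists {c} {t} t≢c = go (path c t) (path-isPath c t)
    where
      go : (w : Walk G c t) → IsPath G w → Σ V (λ a → InBranch G c a t)
      go [ _ ] _ = ⊥-elim (t≢c refl)
      go (step _ {a} ad w) (c∉w ∷ _) = a , ad , w , All¬⇒¬Any c∉w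

  avoids-or-through : ∀ c x y → Avoids c x y ⊎ (d x y ≡ d x c + d c y)
  avoids-or-through c x y with c ∈? verts G (path x y)
  ... | no c∉ = inj₁ (path x y , c∉)
  ... | yes c∈ with split (path x y) (path-isPath x y) c∈
  ...   | splitAt pre suf ppre psuf ls _ =
          inj₂ (trans (sym ls) (cong₂ _+_ (path-len pre ppre) (path-len suf psuf)))

  d-through : ∀ {c x y} → ¬ Avoids c x y → d x y ≡ d x c + d c y
  d-through {c} {x} {y} ¬av with avoids-or-through c x y
  ... | inj₁ av = ⊥-elim (¬av av)
  ... | inj₂ e = e

  -- if d x y = d x c + d c y, the shortest walk via c is the path, so c is on it
  d-not-through : ∀ {c x y} → Avoids c x y → d x y ≢ d x c + d c y
  d-not-through {c} {x} {y} av hyp with shorten (path x c ++ʷ path c y)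
  ... | shortening e pe sub le eqv = avoids-path av e pe c∈e
    where
      via-len : len G (path x c ++ʷ path c y) ≡ d x y
      via-len = trans (len-++ (path x c) (path c y)) (sym hyp)
      e-len : len G e ≡ len G (path x c ++ʷ path c y)
      e-len = ≤-antisym le (subst (_≤ len G e) (sym via-len) (d-min e))
      c∈e : c ∈ₗ verts G e
      c∈e = subst (c ∈ₗ_) (sym (eqv e-len)) (∈-++⁺ʳ (path x c) (path c y) (head∈ (path c y)))

module Rooted {n : ℕ} (G : Graph n) (T : IsTree G) (v : Fin n) where
  open IsTree T renaming (sym to adj-sym)
  open TreeMetric G T
  open import Data.List.Membership.DecPropositional (_≟F_ {n}) using (_∈?_)

  depth : V → ℕ
  depth = d v

  depth-root : depth v ≡ 0
  depth-root = d-refl v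

  adj-depth : ∀ {a b} → Adj G a b → (depth b ≡ suc (depth a)) ⊎ (depth a ≡ suc (depth b))
  adj-depth {a} {b} ab with a ∈? verts G (path v b)
  ... | yes a∈ with split (path v b) (path-isPath v b) a∈
  ...   | splitAt pre suf ppre psuf ls _ = inj₁ (begin
          depth b                      ≡⟨ sym ls ⟩
          len G pre + len G suf        ≡⟨ cong₂ _+_ (path-len pre ppre) (trans (path-len suf psuf) (adj⇒d≡1 ab)) ⟩
          depth a + 1                  ≡⟨ +-comm (depth a) 1 ⟩
          suc (depth a)                ∎)
    where open ≡-Reasoning
  adj-depth {a} {b} ab | no a∉ = inj₂ (begin
          depth a                                   ≡⟨ sym (path-len _ (snoc-path (path v b) (path-isPath v b) a∉ (adj-sym a b ab))) ⟩
          len G (path v b ++ʷ step b _ [ a ])        ≡⟨ len-++ (path v b) _ ⟩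
          depth b + 1                               ≡⟨ +-comm (depth b) 1 ⟩
          suc (depth b)                             ∎)
    where open ≡-Reasoning

  depth-lipschitz : ∀ {a b} → Adj G a b → depth a ≤ suc (depth b)
  depth-lipschitz {a} {b} ab with adj-depth ab
  ... | inj₁ e = ≤-trans (n≤1+n (depth a)) (subst (_≤ suc (depth b)) e (n≤1+n (depth b)))
  ... | inj₂ e = subst (_≤ suc (depth b)) (sym e) ≤-refl

  -- a vertex other than the root has a parent: the next vertex on its path to v
  parent-exists : ∀ {x} → x ≢ v → Σ V (λ a → Adj G a x × suc (depth a) ≡ depth x)
  parent-exists {x} x≢v = go (path x v) (path-isPath x v)
    where
      go : (w : Walk G x v) → IsPath G w → Σ V (λ a → Adj G a x × suc (depth a) ≡ depth x)
      go [ _ ] _ = ⊥-elim (x≢v refl)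
      go (step _ {a} ad w) pp@(_ ∷ pw) = a , adj-sym x a ad ,
        trans (cong suc (trans (d-sym v a) (sym (path-len w pw)))) (trans (path-len (step x ad w) pp) (d-sym x v))

  parent-avoids : ∀ {c z} → Adj G c z → suc (depth c) ≡ depth z → Avoids z v c
  parent-avoids {c} {z} cz ec with avoids-or-through z v c
  ... | inj₁ r = r
  ... | inj₂ e = ⊥-elim (m≢1+m+n (depth z) (begin
        depth z                  ≡⟨ sym ec ⟩
        suc (depth c)            ≡⟨ cong suc e ⟩
        suc (depth z + d z c)    ≡⟨ cong (λ k → suc (depth z + k)) (adj⇒d≡1 (adj-sym c z cz)) ⟩
        suc (depth z + 1)        ∎))
    where open ≡-Reasoning

  parent-unique : ∀ {a b z} → Adj G a z → Adj G b z → suc (depth a) ≡ depth z → suc (depth b) ≡ depth z → a ≡ b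
  parent-unique {a} {b} {z} az bz ea eb =
    sym (neighbour-unique (adj-sym a z az) (adj-sym b z bz)
                          (Avoids-trans (Avoids-sym (parent-avoids az ea)) (parent-avoids bz eb)))

  parent≢child : ∀ {π c q} → suc (depth π) ≡ depth c → depth q ≡ suc (depth c) → π ≢ q
  parent≢child {π} {c} e1 e2 refl = m≢1+m+n (depth c) (trans (sym e1) (cong suc (trans e2 (+-comm 1 (depth c)))))

  descent-stays-deep : ∀ {a q y} (ad : Adj G a q) (w : Walk G q y) → IsPath G (step a ad w) →
    depth q ≡ suc (depth a) → suc (depth a) ≤ depth y
  descent-stays-deep ad [ _ ] _ e = subst (_ ≤_) (sym e) ≤-refl
  descent-stays-deep {a} {q} ad (step _ {q₂} ad₂ w') ((_ ∷ a∉w) ∷ pw) e with adj-depth ad₂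
  ... | inj₁ e₂ = ≤-trans (subst (suc (depth a) ≤_) (sym e) ≤-refl)
                          (≤-trans (n≤1+n (depth q)) (descent-stays-deep ad₂ w' pw e₂))
  ... | inj₂ e₂ = ⊥-elim (all-head w' a∉w (parent-unique ad (adj-sym q q₂ ad₂) (sym e) (sym e₂)))

  record Turn (x y : V) (Q : List V) : Set where
    constructor turn
    field
      c qa qb : V
      c-qa    : Adj G c qa
      c-qb    : Adj G c qb
      qa≢qb   : qa ≢ qb
      depth-qa : depth qa ≡ suc (depth c)
      depth-qb : depth qb ≡ suc (depth c)
      c∈Q     : c ∈ₗ Q
      x-qa    : Avoids c x qa
      qb-y    : Avoids c qb y

  -- a path from x whose current edge a–q climbs, and which ends no higher than a,
  -- turns somewhere after a (the part before a is kept in pre)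
  find-turn : ∀ {x a q y} (pre : Walk G x a) (ad : Adj G a q) (w : Walk G q y) → IsPath G (step a ad w) →
    (∀ {z} → z ∈ₗ verts G w → z ∉ₗ verts G pre) → suc (depth q) ≡ depth a → depth a ≤ depth y →
    Turn x y (verts G (step a ad w))
  find-turn pre ad [ _ ] _ _ e le = ⊥-elim (1+n≰n (subst (_≤ _) (sym e) le))
  find-turn {x} {a} {q} {y} pre ad (step _ {q₂} ad₂ w') ((a∉ ∷ a∉w) ∷ pq@(q∉ ∷ pw)) disj e le with adj-depth ad₂
  ... | inj₁ e₂ = turn q a q₂ (adj-sym a q ad) ad₂ (all-head w' a∉w) (sym e) e₂ (there (here refl))
                       (pre , disj (here refl)) (w' , All¬⇒¬Any q∉)
  ... | inj₂ e₂ with find-turn (pre ++ʷ step a ad [ q ]) ad₂ w' pq disj'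
                               (sym e₂) (≤-trans (n≤1+n (depth q)) (subst (_≤ depth y) (sym e) le))
    where
      disj' : ∀ {z} → z ∈ₗ verts G w' → z ∉ₗ verts G (pre ++ʷ step a ad [ q ])
      disj' {z} m m₂ with ∈-++⁻ pre _ m₂
      ... | inj₁ m₃ = disj (there m) m₃
      ... | inj₂ (here refl) = All¬⇒¬Any (a∉ ∷ a∉w) (there m)
      ... | inj₂ (there (here refl)) = All¬⇒¬Any q∉ m
  ...   | turn c qa qb c-qa c-qb ne dqa dqb c∈ x-qa qb-y = turn c qa qb c-qa c-qb ne dqa dqb (there c∈) x-qa qb-y

  intermediate-depth : ∀ {t z} (w : Walk G t z) m → 1 ≤ m → m ≤ depth t → depth z < m →
    Σ V (λ s → s ∈ₗ verts G w × depth s ≡ m × Avoids v t s)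
  intermediate-depth [ _ ] m _ le lt = ⊥-elim (<-irrefl refl (≤-trans lt le))
  intermediate-depth {t} (step _ {q} ad w) m m≥1 le lt with depth t ≟ m
  ... | yes e = t , here refl , e , [ t ] , λ { (here e') → t≢v (sym e') }
    where
      t≢v : t ≢ v
      t≢v e' = 1+n≰n (≤-trans m≥1 (subst (m ≤_) (trans (cong depth e') depth-root) le))
  ... | no ne with intermediate-depth w m m≥1
                     (s≤s⁻¹ (≤-trans (≤∧≢⇒< le (λ e' → ne (sym e'))) (depth-lipschitz ad))) lt
  ...   | s , s∈ , ds , (rw , av) = s , there s∈ , ds , step t ad rw , λ { (here e') → t≢v e' ; (there k) → av k }
    where
      t≢v : v ≡ t → ⊥
      t≢v e' = 1+n≰n (≤-trans m≥1 (subst (m ≤_) (trans (cong depth (sym e')) depth-root) le))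

  module BelowParent (w π : V) (π-w : Adj G π w) (depth-π : suc (depth π) ≡ depth w) where
    parent-to-root : Avoids w π v
    parent-to-root = Avoids-sym (parent-avoids π-w depth-π)

    child-depth : ∀ {q} → Adj G w q → q ≢ π → depth q ≡ suc (depth w)
    child-depth {q} aq ne with adj-depth aq
    ... | inj₁ e = e
    ... | inj₂ e = ⊥-elim (ne (parent-unique (adj-sym w q aq) π-w (sym e) depth-π))

    is-child : ∀ {q z} → Adj G w q → q ≢ π → Avoids w q z → depth z ≡ suc (depth w) → z ≡ q
    is-child {q} {z} aq ne r e with avoids-or-through w v z
    ... | inj₁ r' = ⊥-elim (ne (neighbour-unique (adj-sym π w π-w) aq
                                  (Avoids-trans (Avoids-trans parent-to-root r') (Avoids-sym r))))
    ... | inj₂ e' = neighbour-unique aq (d≡1⇒adj dw1) r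
      where
        dw1 : d w z ≡ 1
        dw1 = +-cancelˡ-≡ (depth w) _ _ (trans (sym e') (trans e (+-comm 1 (depth w))))

module Neighbourhoods {n : ℕ} (G : Graph n) where

  nbhd : Fin n → Subset n
  nbhd c = tabulate (G c)

  adj⇒∈nbhd : ∀ {c x} → Adj G c x → x ∈ nbhd c
  adj⇒∈nbhd {c} {x} a = lookup⇒[]= x (nbhd c) (trans (lookup∘tabulate (G c) x) a)

  ∈nbhd⇒adj : ∀ {c x} → x ∈ nbhd c → Adj G c x
  ∈nbhd⇒adj {c} {x} m = trans (sym (lookup∘tabulate (G c) x)) ([]=⇒lookup m)

  distinct-neighbours≤deg : ∀ {c} (xs : List (Fin n)) → Unique xs → All (Adj G c) xs → length xs ≤ deg G c
  distinct-neighbours≤deg xs u as = distinct≤∣p∣ xs u (All-map adj⇒∈nbhd as)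

  three-neighbours⇒core : ∀ {c x y z} → Adj G c x → Adj G c y → Adj G c z → x ≢ y → x ≢ z → y ≢ z → IsCore G c
  three-neighbours⇒core {c} {x} {y} {z} ax ay az x≢y x≢z y≢z =
    distinct-neighbours≤deg (x ∷ y ∷ z ∷ []) ((x≢y ∷ x≢z ∷ []) ∷ (y≢z ∷ []) ∷ [] ∷ []) (ax ∷ ay ∷ az ∷ [])

  degree-3-neighbours : ∀ {c z₁ z₂ z₃} → deg G c ≡ 3 → Adj G c z₁ → Adj G c z₂ → Adj G c z₃ →
    z₁ ≢ z₂ → z₁ ≢ z₃ → z₂ ≢ z₃ → ∀ u → Adj G c u → (u ≡ z₁) ⊎ (u ≡ z₂) ⊎ (u ≡ z₃)
  degree-3-neighbours {c} {z₁} {z₂} {z₃} d3 a₁ a₂ a₃ n₁₂ n₁₃ n₂₃ u au with u ≟F z₁ | u ≟F z₂ | u ≟F z₃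
  ... | yes e | _ | _ = inj₁ e
  ... | no _ | yes e | _ = inj₂ (inj₁ e)
  ... | no _ | no _ | yes e = inj₂ (inj₂ e)
  ... | no m₁ | no m₂ | no m₃ = ⊥-elim (1+n≰n (subst (4 ≤_) d3 (distinct-neighbours≤deg (z₁ ∷ z₂ ∷ z₃ ∷ u ∷ [])
          ((n₁₂ ∷ n₁₃ ∷ (λ e → m₁ (sym e)) ∷ []) ∷ (n₂₃ ∷ (λ e → m₂ (sym e)) ∷ []) ∷ ((λ e → m₃ (sym e)) ∷ []) ∷ [] ∷ [])
          (a₁ ∷ a₂ ∷ a₃ ∷ au ∷ []))))

module Landmark {n : ℕ} (G : Graph n) (T : IsTree G) (v : Fin n) (v-core : IsCore G v)
                (gleg : ∀ u → Adj G v u → IsGLeg G v u)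
                (L S : Subset n) (S⊆L : _⊆ₛ_ G S L) (local : IsLocalSet G v S) where
  open IsTree T renaming (sym to adj-sym)
  open TreeMetric G T
  open Rooted G T v
  open Neighbourhoods G
  open IsLocalSet local

  Hypothesis : Set
  Hypothesis = (∀ u → Adj G v u → ∃ λ x → InBranch G v u x × x ∈ L)
             ⊎ 4 ≤ deg G v
             ⊎ (∃ λ u₁ → ∃ λ u₂ → ∃ λ w₁ → ∃ λ w₂ → u₁ ≢ u₂ × IsModLeg G v u₁ w₁ × IsModLeg G v u₂ w₂)
             ⊎ v ∈ L

  Resolved : V → V → Set
  Resolved x y = ∃₂ λ τ₁ τ₂ → τ₁ ∈ L × τ₂ ∈ L × τ₁ ≢ τ₂ × Separates G τ₁ x y × Separates G τ₂ x y

  resolved : ∀ {x y τ₁ τ₂} → τ₁ ∈ L → τ₂ ∈ L → τ₁ ≢ τ₂ → d x τ₁ ≢ d y τ₁ → d x τ₂ ≢ d y τ₂ → Resolved x y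
  resolved {τ₁ = τ₁} {τ₂} i₁ i₂ ne s₁ s₂ = τ₁ , τ₂ , i₁ , i₂ , ne , separates s₁ , separates s₂
    where
      separates : ∀ {τ x y} → d x τ ≢ d y τ → Separates G τ x y
      separates ne k dx dy = ne (trans (sym (dist-uniq dx)) (dist-uniq dy))

  Resolved-sym : ∀ {x y} → Resolved x y → Resolved y x
  Resolved-sym (τ₁ , τ₂ , i₁ , i₂ , ne , s₁ , s₂) = τ₁ , τ₂ , i₁ , i₂ , ne , (λ k a b → s₁ k b a) , (λ k a b → s₂ k b a)

  Br : V → V → Set
  Br a t = InBranch G v a t

  v∉Br : ∀ {a} → ¬ Br a v
  v∉Br (_ , w , v∉w) = v∉w (last∈ w)

  Br-extend : ∀ {a t s} → Br a t → Avoids v t s → Br a s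
  Br-extend (ad , r) r₂ = ad , Avoids-trans r r₂

  Br-connected : ∀ {a t s} → Br a t → Br a s → Avoids v t s
  Br-connected bt bs = Avoids-trans (Avoids-sym (proj₂ bt)) (proj₂ bs)

  Br-disjoint : ∀ {a b t s} → Br a t → Br b s → a ≢ b → t ≢ s
  Br-disjoint bt bs ne refl = ne (branch-unique bt bs)

  inL : ∀ {a t} → InSL G S v a t → t ∈ L
  inL (_ , m) = S⊆L _ m

  standard≢modified : ∀ {a w} → IsLeg G v a → IsModLeg G v a w → ⊥
  standard≢modified (_ , no-core) (_ , w∈a , (d3 , _) , _) = no-core _ w∈a (subst (3 ≤_) (sym d3) ≤-refl)

  -- a leg at a neighbour u of v is short or long, decided by the degree of u
  short-or-long : ∀ {u} → Adj G v u → IsShort G v u ⊎ IsLong G v u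
  short-or-long {u} v-u with 2 ≤? deg G u
  ... | yes h with nonempty (others {p = nbhd u} 1 v h)
  ...   | b , b∈ = inj₂ λ short → irrefl u (subst (Adj G u) (short b (v-u , step u u-b [ b ] , v∉)) u-b)
    where
      u-b : Adj G u b
      u-b = ∈nbhd⇒adj (remove-⊆ b∈)
      v∉ : v ∉ₗ (u ∷ b ∷ [])
      v∉ (here e) = irrefl u (subst (λ z → Adj G z u) e v-u)
      v∉ (there (here e)) = remove-≢ b∈ (sym e)
  short-or-long {u} v-u | no h = inj₁ short
    where
      only-v : ∀ t → Adj G u t → t ≡ v
      only-v t u-t with t ≟F v
      ... | yes e = e
      ... | no ne = ⊥-elim (h (distinct-neighbours≤deg (v ∷ t ∷ []) (((λ e → ne (sym e)) ∷ []) ∷ [] ∷ [])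
                                                      (adj-sym v u v-u ∷ u-t ∷ [])))
      short : IsShort G v u
      short t (_ , [ _ ] , _) = refl
      short t (_ , step _ a w , v∉) = ⊥-elim (v∉ (there (subst (_∈ₗ verts G w) (only-v _ a) (head∈ w))))

  Hit : V → Set
  Hit a = ∃ λ t → InSL G S v a t

  standard-hit : ∀ {a} → IsLeg G v a → TypeS0 G S v a ⊎ Hit a
  standard-hit {a} lg with c1-types a lg
  ... | inj₁ s0 = inj₁ s0
  ... | inj₂ (inj₁ (t , m , _)) = inj₂ (t , m)
  ... | inj₂ (inj₂ (inj₁ (t , _ , _ , m , _))) = inj₂ (t , m)
  ... | inj₂ (inj₂ (inj₂ (m , _))) = inj₂ (_ , m)

  modified-hit : ∀ {a w} → IsModLeg G v a w → Hit a
  modified-hit {a} {w} ml with c2 a w ml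
  ... | inj₁ (t , _ , m , _) = t , m
  ... | inj₂ (inj₁ (_ , _ , _ , t , _ , _ , m , _)) = t , m
  ... | inj₂ (inj₂ ((t , _ , _ , m , _) , _)) = t , m

  modified-twice : ∀ {a w} → IsModLeg G v a w → TypeM1 G S v a w ⊎ TwoIn G S v a
  modified-twice {a} {w} ml with c2 a w ml
  ... | inj₁ m1 = inj₁ m1
  ... | inj₂ (inj₁ (_ , _ , _ , t , u , ne , mt , mu , _)) = inj₂ (t , u , ne , mt , mu)
  ... | inj₂ (inj₂ (two , _)) = inj₂ two

  branch-hit : ∀ {a} → Adj G v a → (IsLeg G v a × TypeS0 G S v a) ⊎ Hit a
  branch-hit {a} ad with gleg a ad
  ... | inj₂ (w , ml) = inj₂ (modified-hit ml)
  ... | inj₁ lg with standard-hit lg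
  ...   | inj₁ s0 = inj₁ (lg , s0)
  ...   | inj₂ h = inj₂ h

  -- Case I: vertices at different depths.

  Outside : V → V → Set
  Outside a₀ t = (t ≡ v) ⊎ Σ V (λ b → b ≢ a₀ × Br b t)

  -- what Case I needs: two vertices of L outside the branch a₀ of x
  TwoOutside : V → Set
  TwoOutside a₀ = ∃₂ λ t₁ t₂ → t₁ ∈ L × t₂ ∈ L × t₁ ≢ t₂ × Outside a₀ t₁ × Outside a₀ t₂

  two-hits : ∀ {a₀ o₁ o₂} → o₁ ≢ o₂ → o₁ ≢ a₀ → o₂ ≢ a₀ → Hit o₁ → Hit o₂ → TwoOutside a₀
  two-hits ne n₁ n₂ (t₁ , m₁) (t₂ , m₂) =
    t₁ , t₂ , inL m₁ , inL m₂ , Br-disjoint (proj₁ m₁) (proj₁ m₂) ne , inj₂ (_ , n₁ , proj₁ m₁) , inj₂ (_ , n₂ , proj₁ m₂)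

  Other : V → V → Set
  Other a₀ o = Adj G v o × o ≢ a₀

  other : ∀ {a₀ o} → o ∈ remove (nbhd v) a₀ → Other a₀ o
  other o∈ = ∈nbhd⇒adj (remove-⊆ o∈) , remove-≢ o∈

  -- among three branches at most one is an empty standard leg
  three-branches : ∀ {a₀ p₁ p₂ p₃} → Other a₀ p₁ → Other a₀ p₂ → Other a₀ p₃ → p₁ ≢ p₂ → p₁ ≢ p₃ → p₂ ≢ p₃ →
    TwoOutside a₀
  three-branches (a₁ , n₁) (a₂ , n₂) (a₃ , n₃) n₁₂ n₁₃ n₂₃ with branch-hit a₁ | branch-hit a₂ | branch-hit a₃
  ... | inj₂ h₁ | inj₂ h₂ | _ = two-hits n₁₂ n₁ n₂ h₁ h₂
  ... | inj₂ h₁ | inj₁ _ | inj₂ h₃ = two-hits n₁₃ n₁ n₃ h₁ h₃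
  ... | inj₁ _ | inj₂ h₂ | inj₂ h₃ = two-hits n₂₃ n₂ n₃ h₂ h₃
  ... | _ | inj₁ (l₂ , s₂) | inj₁ (l₃ , s₃) = ⊥-elim (n₂₃ (c1-atMostOne _ _ l₂ l₃ s₂ s₃))
  ... | inj₁ (l₁ , s₁) | inj₁ (l₂ , s₂) | inj₂ _ = ⊥-elim (n₁₂ (c1-atMostOne _ _ l₁ l₂ s₁ s₂))
  ... | inj₁ (l₁ , s₁) | inj₂ _ | inj₁ (l₃ , s₃) = ⊥-elim (n₁₃ (c1-atMostOne _ _ l₁ l₃ s₁ s₃))

  degree-4 : ∀ a₀ → 4 ≤ deg G v → TwoOutside a₀
  degree-4 a₀ h with members₃ (others {p = nbhd v} 3 a₀ h)
  ... | p₁ , p₂ , p₃ , m₁ , m₂ , m₃ , n₁₂ , n₁₃ , n₂₃ = three-branches (other m₁) (other m₂) (other m₃) n₁₂ n₁₃ n₂₃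

  -- Two branches besides that of a₀, the first an empty standard leg: here the
  -- alternative hypotheses of the theorem are needed.
  one-empty : ∀ {a₀ o₁ o₂} → Hypothesis → Other a₀ o₁ → Other a₀ o₂ → o₁ ≢ o₂ →
    IsLeg G v o₁ → TypeS0 G S v o₁ → Hit o₂ → TwoOutside a₀
  one-empty (inj₁ every-branch-in-L) (a₁ , n₁) (_ , n₂) ne _ _ (t₂ , m₂) with every-branch-in-L _ a₁
  ... | t₁ , b₁ , i₁ = t₁ , t₂ , i₁ , inL m₂ , Br-disjoint b₁ (proj₁ m₂) ne , inj₂ (_ , n₁ , b₁) , inj₂ (_ , n₂ , proj₁ m₂)
  one-empty {a₀} (inj₂ (inj₁ deg≥4)) _ _ _ _ _ _ = degree-4 a₀ deg≥4
  one-empty (inj₂ (inj₂ (inj₂ v∈L))) _ (_ , n₂) _ _ _ (t₂ , m₂) =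
    v , t₂ , v∈L , inL m₂ , (λ e → v∉Br (subst (Br _) (sym e) (proj₁ m₂))) , inj₁ refl , inj₂ (_ , n₂ , proj₁ m₂)
  one-empty {a₀} {o₁} {o₂} (inj₂ (inj₂ (inj₁ (M₁ , M₂ , w₁ , w₂ , M₁≢M₂ , ml₁ , ml₂)))) (a₁ , n₁) (a₂ , n₂) ne l₁ s₁ h₂
    with gleg o₂ a₂
  ... | inj₂ (w , ml) with modified-twice ml
  ...   | inj₁ m1 = ⊥-elim (c3 o₁ l₁ s₁ o₂ w ml m1)
  ...   | inj₂ (t , u , t≢u , mt , mu) = t , u , inL mt , inL mu , t≢u , inj₂ (o₂ , n₂ , proj₁ mt) , inj₂ (o₂ , n₂ , proj₁ mu)
  one-empty {a₀} {o₁} {o₂} (inj₂ (inj₂ (inj₁ (M₁ , M₂ , w₁ , w₂ , M₁≢M₂ , ml₁ , ml₂)))) (a₁ , n₁) (a₂ , n₂) ne l₁ s₁ h₂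
    | inj₁ l₂ with M₁ ≟F a₀
  ... | yes M₁≡a₀ = two-hits (λ e → standard≢modified l₂ (subst (λ z → IsModLeg G v z w₂) e ml₂))
                             (λ e → M₁≢M₂ (trans M₁≡a₀ (sym e))) n₂ (modified-hit ml₂) h₂
  ... | no M₁≢a₀ = two-hits (λ e → standard≢modified l₂ (subst (λ z → IsModLeg G v z w₁) e ml₁)) M₁≢a₀ n₂ (modified-hit ml₁) h₂

  two-outside : ∀ a₀ → Hypothesis → TwoOutside a₀
  two-outside a₀ H with members₂ (others {p = nbhd v} 2 a₀ v-core)
  ... | o₁ , o₂ , m₁ , m₂ , ne with other m₁ | other m₂
  ...   | oth₁@(a₁ , _) | oth₂@(a₂ , _) with branch-hit a₁ | branch-hit a₂
  ...     | inj₂ h₁ | inj₂ h₂ = two-hits ne (proj₂ oth₁) (proj₂ oth₂) h₁ h₂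
  ...     | inj₁ (l₁ , s₁) | inj₂ h₂ = one-empty H oth₁ oth₂ ne l₁ s₁ h₂
  ...     | inj₂ h₁ | inj₁ (l₂ , s₂) = one-empty H oth₂ oth₁ (λ e → ne (sym e)) l₂ s₂ h₁
  ...     | inj₁ (l₁ , s₁) | inj₁ (l₂ , s₂) = ⊥-elim (ne (c1-atMostOne _ _ l₁ l₂ s₁ s₂))

  -- a vertex t outside the branch of x is reached from x through v, so it is
  -- farther from x than from any shallower y
  outside-separates : ∀ {a₀ x y t} → Br a₀ x → depth y < depth x → Outside a₀ t → d x t ≢ d y t
  outside-separates {a₀} {x} {y} {t} x∈a₀ lt out eq = <-irrefl refl (begin-strict
    d y t                ≤⟨ d-triangle y v t ⟩
    d y v + depth t      ≡⟨ cong (_+ depth t) (d-sym y v) ⟩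
    depth y + depth t    <⟨ +-monoˡ-< (depth t) lt ⟩
    depth x + depth t    ≡⟨ cong (_+ depth t) (d-sym v x) ⟩
    d x v + depth t      ≡⟨ sym (d-through (¬avoids out)) ⟩
    d x t                ≡⟨ eq ⟩
    d y t                ∎)
    where
      open ≤-Reasoning
      ¬avoids : Outside a₀ t → ¬ Avoids v x t
      ¬avoids (inj₁ t≡v) r = v∉Br (subst (Br a₀) t≡v (Br-extend x∈a₀ r))
      ¬avoids (inj₂ (b , b≢a₀ , t∈b)) r = b≢a₀ (branch-unique t∈b (Br-extend x∈a₀ r))

  case-I : ∀ {x y} → Hypothesis → depth y < depth x → Resolved x y
  case-I {x} {y} H lt with branch-exists {v} {x} x≢v
    where
      x≢v : x ≢ v
      x≢v refl = <⇒≱ lt (subst (_≤ depth y) (sym depth-root) z≤n)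
  ... | a₀ , x∈a₀ with two-outside a₀ H
  ...   | t₁ , t₂ , i₁ , i₂ , ne , o₁ , o₂ =
          resolved i₁ i₂ ne (outside-separates x∈a₀ lt o₁) (outside-separates x∈a₀ lt o₂)

  -- Case IIa: equal depths, different branches.

  -- a vertex t in the branch of x is closer to x than to a vertex y of the same
  -- depth in another branch, as the path from y to t passes through v
  branch-separates : ∀ {a b x y t} → Br a x → Br b y → a ≢ b → depth x ≡ depth y → Br a t → d x t ≢ d y t
  branch-separates {a} {b} {x} {y} {t} x∈a y∈b ne e t∈a eq = d-not-through (Br-connected t∈a x∈a) (begin
    d t x                ≡⟨ d-sym t x ⟩
    d x t                ≡⟨ eq ⟩
    d y t                ≡⟨ d-sym y t ⟩
    d t y                ≡⟨ d-through (λ r → ne (branch-unique (Br-extend t∈a r) y∈b)) ⟩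
    d t v + depth y      ≡⟨ cong (d t v +_) (sym e) ⟩
    d t v + depth x      ∎)
    where open ≡-Reasoning

  short-leg-in-L : ∀ {a₀ a y} → IsLeg G v a₀ → TypeS0 G S v a₀ → a₀ ≢ a → IsLeg G v a → IsShort G v a →
    Br a y → y ∈ L
  short-leg-in-L {a₀} {a} {y} l₀ s₀ ne lg short y∈a with c1-types a lg
  ... | inj₁ s0 = ⊥-elim (ne (c1-atMostOne _ _ l₀ lg s₀ s0))
  ... | inj₂ (inj₁ (t , (t∈a , _) , _ , k , dk , 2≤k)) =
          ⊥-elim (1+n≰n (subst (2 ≤_) (trans (dist-uniq dk) (trans (cong depth (short t t∈a)) (adj⇒d≡1 (proj₁ lg)))) 2≤k))
  ... | inj₂ (inj₂ (inj₁ (t , u , t≢u , mt , mu))) = ⊥-elim (t≢u (trans (short t (proj₁ mt)) (sym (short u (proj₁ mu)))))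
  ... | inj₂ (inj₂ (inj₂ (m , _))) = subst (_∈ L) (sym (short y y∈a)) (inL m)

  beside-empty-leg : ∀ {ax ay x y} → IsLeg G v ax → TypeS0 G S v ax → Adj G v ay → ax ≢ ay →
    Br ax x → Br ay y → y ∉ L → depth x ≡ depth y → TwoIn G S v ay
  beside-empty-leg {ax} {ay} {x} {y} lx sx v-ay ne x∈ax y∈ay y∉L e with gleg ay v-ay
  ... | inj₂ (w , ml) with modified-twice ml
  ...   | inj₁ m1 = ⊥-elim (c3 ax lx sx ay w ml m1)
  ...   | inj₂ two = two
  beside-empty-leg {ax} {ay} {x} {y} lx sx v-ay ne x∈ax y∈ay y∉L e | inj₁ ly
    with short-or-long (proj₁ lx) | short-or-long v-ay
  ... | _ | inj₁ short-y = ⊥-elim (y∉L (short-leg-in-L lx sx ne ly short-y y∈ay))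
  ... | inj₂ long-x | inj₂ long-y = c4 ax lx long-x sx ay ly long-y (λ q → ne (sym q))
  ... | inj₁ short-x | inj₂ long-y with c5 ax lx short-x sx ay ly long-y
  ...   | inj₁ two = two
  ...   | inj₂ (ay∈S , _) = ⊥-elim (y∉L (subst (_∈ L) (sym y≡ay) (inL ay∈S)))
    where
      -- y is as deep as the vertex x of the short leg ax, i.e. adjacent to v
      y≡ay : y ≡ ay
      y≡ay = neighbour-unique v-ay (d≡1⇒adj (trans (sym e) (trans (cong depth (short-x x x∈ax)) (adj⇒d≡1 (proj₁ lx)))))
                                   (proj₂ y∈ay)

  resolved-by-two : ∀ {a x y} → TwoIn G S v a → (∀ {t} → Br a t → d x t ≢ d y t) → Resolved x y
  resolved-by-two (t , u , t≢u , mt , mu) sep = resolved (inL mt) (inL mu) t≢u (sep (proj₁ mt)) (sep (proj₁ mu))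

  case-IIa : ∀ {x y ax ay} → Adj G v ax → Adj G v ay → ax ≢ ay → Br ax x → Br ay y → x ∉ L → y ∉ L →
    depth x ≡ depth y → Resolved x y
  case-IIa {x} {y} {ax} {ay} v-ax v-ay ne x∈ax y∈ay x∉L y∉L e = go (branch-hit v-ax) (branch-hit v-ay)
    where
      sep-x : ∀ {t} → Br ax t → d x t ≢ d y t
      sep-x = branch-separates x∈ax y∈ay ne e
      sep-y : ∀ {t} → Br ay t → d x t ≢ d y t
      sep-y t∈ eq = branch-separates y∈ay x∈ax (λ q → ne (sym q)) (sym e) t∈ (sym eq)
      go : (IsLeg G v ax × TypeS0 G S v ax) ⊎ Hit ax → (IsLeg G v ay × TypeS0 G S v ay) ⊎ Hit ay → Resolved x y
      go (inj₂ (t₁ , m₁)) (inj₂ (t₂ , m₂)) =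
        resolved (inL m₁) (inL m₂) (Br-disjoint (proj₁ m₁) (proj₁ m₂) ne) (sep-x (proj₁ m₁)) (sep-y (proj₁ m₂))
      go (inj₁ (lx , sx)) _ = resolved-by-two (beside-empty-leg lx sx v-ay ne x∈ax y∈ay y∉L e) sep-y
      go (inj₂ _) (inj₁ (ly , sy)) =
        resolved-by-two (beside-empty-leg ly sy v-ax (λ q → ne (sym q)) y∈ay x∈ax x∉L (sym e)) sep-x

  -- Case IIb: equal depths, same branch.

  record TurningCore (a x y : V) : Set where
    constructor turningCore
    field
      c qa qb π : V
      c-qa     : Adj G c qa
      c-qb     : Adj G c qb
      qa≢qb    : qa ≢ qb
      depth-qa : depth qa ≡ suc (depth c)
      depth-qb : depth qb ≡ suc (depth c)
      x-qa     : Avoids c x qa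
      qb-y     : Avoids c qb y
      c∈a      : Br a c
      π-c      : Adj G π c
      depth-π  : suc (depth π) ≡ depth c
      core     : IsCore G c

  -- the turning vertex of a path inside a branch has a parent besides its two
  -- children on the path, hence is a core
  turn⇒core : ∀ {a x y} → Br a x → (Q : Walk G x y) → IsPath G Q → v ∉ₗ verts G Q →
    Turn x y (verts G Q) → TurningCore a x y
  turn⇒core {a} x∈a Q pQ v∉Q (turn c qa qb c-qa c-qb qa≢qb dqa dqb c∈Q x-qa qb-y) =
    turningCore c qa qb π c-qa c-qb qa≢qb dqa dqb x-qa qb-y c∈a π-c dπ
      (three-neighbours⇒core (adj-sym π c π-c) c-qa c-qb (parent≢child dπ dqa) (parent≢child dπ dqb) qa≢qb)
    where
      parent : Σ V (λ π → Adj G π c × suc (depth π) ≡ depth c)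
      parent = parent-exists (λ e → v∉Q (subst (_∈ₗ verts G Q) e c∈Q))
      π : V
      π = proj₁ parent
      π-c : Adj G π c
      π-c = proj₁ (proj₂ parent)
      dπ : suc (depth π) ≡ depth c
      dπ = proj₂ (proj₂ parent)
      prefix : Split c Q
      prefix = split Q pQ c∈Q
      c∈a : Br a c
      c∈a = Br-extend x∈a (Split.pre prefix , λ m → v∉Q (Split.pre⊆ prefix m))

  -- the path between two distinct vertices of equal depth in a branch cannot start
  -- downwards, so it climbs and then turns at a core of the branch
  same-depth-core : ∀ {a x y} → Br a x → Br a y → x ≢ y → depth x ≡ depth y → TurningCore a x y
  same-depth-core {a} {x} {y} x∈a y∈a x≢y e =
    go (path x y) (path-isPath x y) (avoids-path (Br-connected x∈a y∈a) (path x y) (path-isPath x y))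
    where
      go : (Q : Walk G x y) → IsPath G Q → v ∉ₗ verts G Q → TurningCore a x y
      go [ _ ] _ _ = ⊥-elim (x≢y refl)
      go Q@(step _ ad w) pQ@(x∉w ∷ _) v∉Q with adj-depth ad
      ... | inj₁ down = ⊥-elim (1+n≰n (subst (suc (depth x) ≤_) (sym e) (descent-stays-deep ad w pQ down)))
      ... | inj₂ up = turn⇒core x∈a Q pQ v∉Q (find-turn [ x ] ad w pQ disjoint (sym up) (subst (depth x ≤_) e ≤-refl))
        where
          disjoint : ∀ {z} → z ∈ₗ verts G w → z ∉ₗ verts G [ x ]
          disjoint m (here refl) = All¬⇒¬Any x∉w m

  standard-leg-levels : ∀ {a x y} → IsLeg G v a → Br a x → Br a y → x ≢ y → depth x ≢ depth y
  standard-leg-levels (_ , no-core) x∈a y∈a x≢y e = no-core _ (TurningCore.c∈a k) (TurningCore.core k)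
    where
      k : TurningCore _ _ _
      k = same-depth-core x∈a y∈a x≢y e

  module ModifiedLeg {a w : V} (w∈a : Br a w) (deg-w : deg G w ≡ 3) {u₁ u₂ : V} (u₁≢u₂ : u₁ ≢ u₂)
                     (leg₁ : IsLeg G w u₁) (leg₂ : IsLeg G w u₂) (short₁ : IsShort G w u₁)
                     (only-core : ∀ x → Br a x → IsCore G x → x ≡ w) where

    w-u₁ : Adj G w u₁
    w-u₁ = proj₁ leg₁

    w-u₂ : Adj G w u₂
    w-u₂ = proj₁ leg₂

    w≢v : w ≢ v
    w≢v e = v∉Br (subst (Br a) e w∈a)

    parent : Σ V (λ π → Adj G π w × suc (depth π) ≡ depth w)
    parent = parent-exists w≢v

    π : V
    π = proj₁ parent

    π-w : Adj G π w
    π-w = proj₁ (proj₂ parent)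

    depth-π : suc (depth π) ≡ depth w
    depth-π = proj₂ (proj₂ parent)

    open BelowParent w π π-w depth-π

    -- the legs of w point away from v, since v (a core) is reached from π
    leg≢π : ∀ {u} → IsLeg G w u → u ≢ π
    leg≢π (_ , no-core) refl = no-core v (adj-sym π w π-w , parent-to-root) v-core

    depth-u₁ : depth u₁ ≡ suc (depth w)
    depth-u₁ = child-depth w-u₁ (leg≢π leg₁)

    neighbours-of-w : ∀ q → Adj G w q → (q ≡ π) ⊎ (q ≡ u₁) ⊎ (q ≡ u₂)
    neighbours-of-w = degree-3-neighbours deg-w (adj-sym π w π-w) w-u₁ w-u₂
                        (λ e → leg≢π leg₁ (sym e)) (λ e → leg≢π leg₂ (sym e)) u₁≢u₂

    Children : V → V → Set
    Children x y = ((x ≡ u₁ × y ≡ u₂) ⊎ (x ≡ u₂ × y ≡ u₁)) × depth x ≡ suc (depth w)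

    -- the only core of the leg is w, so a path turning at a core turns at w
    core⇒children : ∀ {x y} → depth x ≡ depth y → TurningCore a x y → Children x y
    core⇒children {x} {y} e (turningCore c qa qb _ c-qa c-qb qa≢qb dqa dqb x-qa qb-y c∈a _ _ core)
      with only-core c c∈a core
    ... | refl = match (child u₁ w-u₁ (leg≢π leg₁)) (child u₂ w-u₂ (leg≢π leg₂))
      where
        child : ∀ u → Adj G w u → u ≢ π → (u ≡ qa) ⊎ (u ≡ qb)
        child u w-u u≢π with degree-3-neighbours deg-w (adj-sym π w π-w) c-qa c-qb
                               (parent≢child depth-π dqa) (parent≢child depth-π dqb) qa≢qb u w-u
        ... | inj₁ u≡π = ⊥-elim (u≢π u≡π)
        ... | inj₂ r = r
        match : (u₁ ≡ qa) ⊎ (u₁ ≡ qb) → (u₂ ≡ qa) ⊎ (u₂ ≡ qb) → Children x y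
        match (inj₁ e₁) (inj₁ e₂) = ⊥-elim (u₁≢u₂ (trans e₁ (sym e₂)))
        match (inj₂ e₁) (inj₂ e₂) = ⊥-elim (u₁≢u₂ (trans e₁ (sym e₂)))
        match (inj₁ e₁) (inj₂ e₂) = inj₁ (x≡u₁ , trans y≡qb (sym e₂)) , dx
          where
            x≡u₁ : x ≡ u₁
            x≡u₁ = short₁ x (w-u₁ , subst (λ z → Avoids w z x) (sym e₁) (Avoids-sym x-qa))
            dx : depth x ≡ suc (depth w)
            dx = trans (cong depth x≡u₁) depth-u₁
            y≡qb : y ≡ qb
            y≡qb = is-child c-qb (λ q → parent≢child depth-π dqb (sym q)) qb-y (trans (sym e) dx)
        match (inj₂ e₁) (inj₁ e₂) = inj₂ (trans x≡qa (sym e₂) , y≡u₁) , trans e dy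
          where
            y≡u₁ : y ≡ u₁
            y≡u₁ = short₁ y (w-u₁ , subst (λ z → Avoids w z y) (sym e₁) qb-y)
            dy : depth y ≡ suc (depth w)
            dy = trans (cong depth y≡u₁) depth-u₁
            x≡qa : x ≡ qa
            x≡qa = is-child c-qa (λ q → parent≢child depth-π dqa (sym q)) (Avoids-sym x-qa) (trans e dy)

    same-depth-children : ∀ {x y} → Br a x → Br a y → x ≢ y → depth x ≡ depth y → Children x y
    same-depth-children x∈a y∈a x≢y e = core⇒children e (same-depth-core x∈a y∈a x≢y e)

    w-not-child : ∀ {s} → ¬ Children s w
    w-not-child (inj₁ (_ , w≡u₂) , _) = irrefl w (subst (Adj G w) (sym w≡u₂) w-u₂)
    w-not-child (inj₂ (_ , w≡u₁) , _) = irrefl w (subst (Adj G w) (sym w≡u₁) w-u₁)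

    partner : ∀ {x y z} → Children z x → Children x y → z ≡ y
    partner (inj₁ (z≡u₁ , x≡u₂) , _) (inj₁ (x≡u₁ , _) , _) = ⊥-elim (u₁≢u₂ (trans (sym x≡u₁) x≡u₂))
    partner (inj₁ (z≡u₁ , _) , _) (inj₂ (_ , y≡u₁) , _) = trans z≡u₁ (sym y≡u₁)
    partner (inj₂ (z≡u₂ , _) , _) (inj₁ (_ , y≡u₂) , _) = trans z≡u₂ (sym y≡u₂)
    partner (inj₂ (_ , x≡u₁) , _) (inj₂ (x≡u₂ , _) , _) = ⊥-elim (u₁≢u₂ (trans (sym x≡u₁) x≡u₂))

    -- a vertex of the leg at least two levels below w is closer to u₂ than to u₁:
    -- it lies beyond u₂, since beyond π it would force a second vertex at the level
    -- of w, and beyond the short leg u₁ there is nothing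
    deep-separates : ∀ {t} → Br a t → suc (suc (depth w)) ≤ depth t → d u₁ t ≢ d u₂ t
    deep-separates {t} t∈a deep = via (branch-exists t≢w)
      where
        t≢w : t ≢ w
        t≢w refl = 1+n≰n (≤-trans (n≤1+n _) deep)
        via : Σ V (λ q → InBranch G w q t) → d u₁ t ≢ d u₂ t
        via (q , w-q , q-t) with neighbours-of-w q w-q
        ... | inj₁ refl = λ _ → w-not-child (same-depth-children s∈a w∈a s≢w depth-s)
          where
            t-v : Avoids w t v
            t-v = Avoids-trans (Avoids-sym q-t) parent-to-root
            depth-w≥1 : 1 ≤ depth w
            depth-w≥1 = n≢0⇒n>0 (λ e → w≢v (sym (d≡0 e)))
            level-w : Σ V (λ s → s ∈ₗ verts G (proj₁ t-v) × depth s ≡ depth w × Avoids v t s)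
            level-w = intermediate-depth (proj₁ t-v) (depth w) depth-w≥1 (≤-trans (n≤1+n _) (≤-trans (n≤1+n _) deep))
                        (subst (_< depth w) (sym depth-root) depth-w≥1)
            s : V
            s = proj₁ level-w
            s∈a : Br a s
            s∈a = Br-extend t∈a (proj₂ (proj₂ (proj₂ level-w)))
            s≢w : s ≢ w
            s≢w e = proj₂ t-v (subst (_∈ₗ verts G (proj₁ t-v)) e (proj₁ (proj₂ level-w)))
            depth-s : depth s ≡ depth w
            depth-s = proj₁ (proj₂ (proj₂ level-w))
        ... | inj₂ (inj₁ refl) = λ _ → 1+n≰n (subst (suc (suc (depth w)) ≤_) (trans (cong depth (short₁ t (w-u₁ , q-t))) depth-u₁) deep)
        ... | inj₂ (inj₂ refl) = λ same → d-not-through (Avoids-sym q-t) (begin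
          d t u₂             ≡⟨ d-sym t u₂ ⟩
          d u₂ t             ≡⟨ sym same ⟩
          d u₁ t             ≡⟨ d-sym u₁ t ⟩
          d t u₁             ≡⟨ d-through (λ r → u₁≢u₂ (neighbour-unique w-u₂ w-u₁ (Avoids-trans q-t r))) ⟩
          d t w + d w u₁     ≡⟨ cong (d t w +_) (trans (adj⇒d≡1 w-u₁) (sym (adj⇒d≡1 w-u₂))) ⟩
          d t w + d w u₂     ∎)
          where open ≡-Reasoning

    children-separated : ∀ {x y t} → Children x y → Br a t → suc (suc (depth w)) ≤ depth t → d x t ≢ d y t
    children-separated (inj₁ (refl , refl) , _) t∈a deep = deep-separates t∈a deep
    children-separated (inj₂ (refl , refl) , _) t∈a deep eq = deep-separates t∈a deep (sym eq)

    tip∉L : ∀ {x y z} → Children x y → x ∉ L → y ∉ L → Br a x → IsTip G v a w z → z ∉ L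
    tip∉L {x} {y} {z} ch x∉L y∉L x∈a (z∈a , i , dwi , dzi) z∈L =
      y∉L (subst (_∈ L) (partner (same-depth-children z∈a x∈a z≢x (trans depth-z (sym (proj₂ ch)))) ch) z∈L)
      where
        z≢x : z ≢ x
        z≢x e = x∉L (subst (_∈ L) e z∈L)
        depth-z : depth z ≡ suc (depth w)
        depth-z = trans (sym (dist-uniq dzi)) (cong suc (dist-uniq dwi))

    case-IIb : ∀ {x y} → TypeM1 G S v a w ⊎ TypeM2 G S v a w ⊎ TypeM3 G S v a w →
      Br a x → Br a y → x ≢ y → x ∉ L → y ∉ L → depth x ≡ depth y → Resolved x y
    case-IIb (inj₁ (z , tip , m , _)) x∈a y∈a x≢y x∉L y∉L e =
      ⊥-elim (tip∉L (same-depth-children x∈a y∈a x≢y e) x∉L y∉L x∈a tip (inL m))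
    case-IIb (inj₂ (inj₂ (_ , z , tip , m))) x∈a y∈a x≢y x∉L y∉L e =
      ⊥-elim (tip∉L (same-depth-children x∈a y∈a x≢y e) x∉L y∉L x∈a tip (inL m))
    case-IIb (inj₂ (inj₁ (_ , i , dwi , t , u , t≢u , mt , mu , (k , dtk , t-deep) , (k' , duk , u-deep))))
             x∈a y∈a x≢y x∉L y∉L e =
      resolved (inL mt) (inL mu) t≢u (children-separated ch (proj₁ mt) (deep dtk t-deep))
                                     (children-separated ch (proj₁ mu) (deep duk u-deep))
      where
        ch : Children _ _
        ch = same-depth-children x∈a y∈a x≢y e
        deep : ∀ {s k} → Dist G v s k → suc (suc i) ≤ k → suc (suc (depth w)) ≤ depth s
        deep ds = subst₂ (λ j k → suc (suc j) ≤ k) (dist-uniq dwi) (dist-uniq ds)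

  -- Case IIb: a standard leg has no two vertices at the same depth
  case-IIb : ∀ {a x y} → Adj G v a → Br a x → Br a y → x ≢ y → x ∉ L → y ∉ L → depth x ≡ depth y → Resolved x y
  case-IIb {a} v-a x∈a y∈a x≢y x∉L y∉L e with gleg a v-a
  ... | inj₁ leg = ⊥-elim (standard-leg-levels leg x∈a y∈a x≢y e)
  ... | inj₂ (w , ml@(_ , w∈a , (deg-w , _ , _ , u₁≢u₂ , leg₁ , leg₂ , short₁) , only-core)) =
        ModifiedLeg.case-IIb w∈a deg-w u₁≢u₂ leg₁ leg₂ short₁ only-core (c2 a w ml) x∈a y∈a x≢y x∉L y∉L e

  same-depth-≢root : ∀ {x y} → x ≢ y → depth x ≡ depth y → x ≢ v
  same-depth-≢root x≢y e refl = x≢y (d≡0 (trans (sym e) depth-root))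

  case-II : ∀ {x y} → x ≢ y → x ∉ L → y ∉ L → depth x ≡ depth y → Resolved x y
  case-II {x} {y} x≢y x∉L y∉L e
    with branch-exists (same-depth-≢root x≢y e) | branch-exists (same-depth-≢root (λ q → x≢y (sym q)) (sym e))
  ... | ax , x∈ax | ay , y∈ay with ax ≟F ay
  ...   | yes refl = case-IIb (proj₁ x∈ax) x∈ax y∈ay x≢y x∉L y∉L e
  ...   | no ne = case-IIa (proj₁ x∈ax) (proj₁ y∈ay) ne x∈ax y∈ay x∉L y∉L e

  landmark : Hypothesis → IsLandmark G L
  landmark H x y x∉L y∉L x≢y with <-cmp (depth x) (depth y)
  ... | tri< lt _ _ = Resolved-sym (case-I H lt)
  ... | tri≈ _ e _ = case-II x≢y x∉L y∉L e
  ... | tri> _ _ gt = case-I H gt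

lemma7 : ∀ {n} (G : Graph n) → IsTree G → (v : Fin n) →
    IsCore G v →
    (∀ u → Adj G v u → IsGLeg G v u) →
    (L : Subset n) → ContainsLocalSet G v L →
    ((∀ u → Adj G v u → ∃ λ x → InBranch G v u x × x ∈ L)
      ⊎ 4 ≤ deg G v
      ⊎ (∃ λ u₁ → ∃ λ u₂ → ∃ λ w₁ → ∃ λ w₂ → u₁ ≢ u₂ × IsModLeg G v u₁ w₁ × IsModLeg G v u₂ w₂)
      ⊎ v ∈ L) →
    IsLandmark G L
lemma7 G T v v-core gleg L (S , S⊆L , local) = Landmark.landmark G T v v-core gleg L S S⊆L local
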